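{- If $(T,r,\lambda,c)$ is a Burling tree in which every non-leaf vertex has exactly two children, then there is an integer $i\ge1$ such that $T_i$ (the $i$-th Burling tree of the tree sequence) is an extension of $T$.
   Context: A Burling tree is a 4-tuple $(T,r,\lambda,c)$: $T$ a rooted tree with root $r$; $\lambda$ assigns to each non-leaf $v$ one of its children, its last-born; for $v\neq r$ not a last-born, $c(v)$ is the vertex set of a (possibly empty) branch (downward path $v_1\dots v_k$, each $v_i$ the parent of $v_{i+1}$) starting at the last-born of the parent of $v$, and $c(v)=\varnothing$ if $v$ is a last-born or the root. A principal branch is a branch from the root to a leaf; the principal set is the set of vertex sets of principal branches. $T'=(T',r',\lambda',c')$ is an extension of $T$ if there is an injection $\varphi:V(T)\to V(T')$ with $\varphi(r)=r'$; $\varphi$ maps ancestors to ancestors ($u$ ancestor of $v$ implies $\varphi(u)$ ancestor of $\varphi(v)$); $\varphi$ maps last-borns to last-borns; and $\varphi(c(v))=c'(\varphi(v))\cap\varphi(V(T))$ for all $v$. Tree sequence: given a Burling tree $T$ with principal set $\mathcal S$, $\mathrm{next}_T(T)$ is built by: taking a copy of $T$; for each $P\in\mathcal S$ ending at leaf $l$, adding a child $l_P$ of $l$ declared the last-born of $l$, and attaching a copy $T_P$ of $T$ by identifying its root with $l_P$ (with principal set $\mathcal S_P$); for each such $P$ and each $Q\in\mathcal S_P$ adding a new leaf child $l_{P,Q}$ of $l$; extending $c$ to the copies naturally and setting $c(l_{P,Q})=Q$. $T_1$ is the one-vertex Burling tree and $T_{k+1}=\mathrm{next}_T(T_k)$.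 -}

module Defs where

open import Data.Nat using (ℕ; zero; suc)
open import Data.Fin using (Fin; toℕ)
open import Data.List using (List; []; _∷_; [_]; _++_; map; length; lookup)
open import Data.List.Relation.Unary.All using (All)
open import Data.Maybe using (Maybe; just; nothing)
open import Data.Product using (Σ; _×_; _,_; proj₁; proj₂)
open import Data.Empty using (⊥)
open import Relation.Binary.PropositionalEquality using (_≡_)
open import Relation.Nullary using (¬_)

-- A vertex is either a leaf, or a non-leaf  node lb others  where
--   * lb      is the subtree rooted at its last-born child  λ(v),
--   * others  lists the subtrees rooted at its other children; each other
--             child u carries the label encoding c(u):
--               nothing  = the empty branch,
--               just a   = the branch from the last-born sibling (root of lb)
--                          down to the vertex of lb with address a.
-- (Every downward path starting at the last-born is determined by its
-- endpoint, so this encodes exactly the possible values of c.)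
-- Addresses: child step 0 = last-born, child step (suc i) = i-th other child.

Addr : Set
Addr = List ℕ

data RT : Set where
  leaf : RT
  node : (lb : RT) → (others : List (RT × Maybe Addr)) → RT

data Pos : RT → Set where
  here : ∀ {t} → Pos t
  lbP  : ∀ {l os} → Pos l → Pos (node l os)
  othP : ∀ {l os} (i : Fin (length os)) → Pos (proj₁ (lookup os i)) → Pos (node l os)

addr : ∀ {t} → Pos t → Addr
addr here       = []
addr (lbP p)    = 0 ∷ addr p
addr (othP i p) = suc (toℕ i) ∷ addr p

data _≼_ : ∀ {t} → Pos t → Pos t → Set where
  here≼ : ∀ {t} {q : Pos t} → here ≼ q
  lb≼   : ∀ {l os} {p q : Pos l} → p ≼ q → lbP {l} {os} p ≼ lbP q
  oth≼  : ∀ {l os} {i : Fin (length os)} {p q : Pos (proj₁ (lookup os i))} →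
          p ≼ q → othP {l} {os} i p ≼ othP i q

Anc : ∀ {t} → Pos t → Pos t → Set
Anc u v = u ≼ v × ¬ (u ≡ v)

data IsLB : ∀ {t} → Pos t → Set where
  lb-here : ∀ {l os} → IsLB (lbP {l} {os} here)
  lb-lb   : ∀ {l os} {p : Pos l} → IsLB p → IsLB (lbP {l} {os} p)
  lb-oth  : ∀ {l os} {i : Fin (length os)} {p : Pos (proj₁ (lookup os i))} →
            IsLB p → IsLB (othP {l} {os} i p)

LabMem : ∀ l os → Maybe Addr → Pos (node l os) → Set
LabMem l os nothing  w = ⊥
LabMem l os (just a) w =
  Σ (Pos l) λ tgt → addr tgt ≡ a × Σ (Pos l) λ q → w ≡ lbP q × q ≼ tgt

-- InC v w : w ∈ c(v).  (c(root) = c(last-born) = ∅.)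
mutual
  InC : ∀ {t} → Pos t → Pos t → Set
  InC here w = ⊥
  InC {node l os} (lbP p) w = Σ (Pos l) λ q → w ≡ lbP q × InC p q
  InC {node l os} (othP i p) w =
    SubC (LabMem l os (proj₂ (lookup os i))) (othP i) p w

  SubC : ∀ {s t} → (Pos t → Set) → (Pos s → Pos t) → Pos s → Pos t → Set
  SubC L emb here w = L w
  SubC {s} L emb p@(lbP _) w = Σ (Pos s) λ q → w ≡ emb q × InC p q
  SubC {s} L emb p@(othP _ _) w = Σ (Pos s) λ q → w ≡ emb q × InC p q

data LabOK (l : RT) : Maybe Addr → Set where
  noLab   : LabOK l nothing
  someLab : (p : Pos l) → LabOK l (just (addr p))

data WF : RT → Set where
  leafW : WF leaf
  nodeW : ∀ {l os} → WF l →
          All (λ sm → WF (proj₁ sm) × LabOK l (proj₂ sm)) os → WF (node l os)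

data Binary : RT → Set where
  leafB : Binary leaf
  nodeB : ∀ {l s m} → Binary l → Binary s → Binary (node l ((s , m) ∷ []))

record Extension (t' t : RT) : Set where
  field
    φ      : Pos t → Pos t'
    inj    : ∀ u v → φ u ≡ φ v → u ≡ v
    root   : φ here ≡ here
    anc    : ∀ u v → Anc u v → Anc (φ u) (φ v)
    lastb  : ∀ v → IsLB v → IsLB (φ v)
    cond-c : ∀ v (w' : Pos t') →
             ((Σ (Pos t) λ w → InC v w × φ w ≡ w') → InC (φ v) w' × Σ (Pos t) λ w → φ w ≡ w')
           × ((InC (φ v) w' × Σ (Pos t) λ w → φ w ≡ w') → Σ (Pos t) λ w → InC v w × φ w ≡ w')

-- Addresses of the leaves (= principal branches, a principal branch being
-- determined by its leaf; its vertex set is the root-to-leaf path).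
mutual
  leaves : RT → List Addr
  leaves leaf        = [ [] ]
  leaves (node l os) = map (0 ∷_) (leaves l) ++ leavesO 1 os

  leavesO : ℕ → List (RT × Maybe Addr) → List Addr
  leavesO k []             = []
  leavesO k ((s , _) ∷ os) = map (k ∷_) (leaves s) ++ leavesO (suc k) os

-- graft T S : replace each leaf l of S (principal branch P) by a vertex
-- whose last-born child l_P is the root of a copy T_P of T, and whose
-- other children are new leaves l_{P,Q}, one for each principal branch Q
-- of T_P, with c(l_{P,Q}) = Q (branch from l_P to the leaf of Q).
mutual
  graft : RT → RT → RT
  graft T leaf        = node T (map (λ a → (leaf , just a)) (leaves T))
  graft T (node l os) = node (graft T l) (graftO T os)

  graftO : RT → List (RT × Maybe Addr) → List (RT × Maybe Addr)
  graftO T []             = []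
  graftO T ((s , m) ∷ os) = (graft T s , m) ∷ graftO T os

nextT : RT → RT
nextT T = graft T T

-- Tseq i = T_i for i ≥ 1 (T_1 the one-vertex tree); Tseq 0 is unused.
Tseq : ℕ → RT
Tseq zero          = leaf
Tseq (suc zero)    = leaf
Tseq (suc (suc k)) = nextT (Tseq (suc k))

{-# OPTIONS --safe #-}
-- Induction on the binary tree T = node L [(S , m)], for a stronger invariant: for all large n,
-- T embeds into T_n so that for every vertex z of T some principal branch of T_n meets the image
-- exactly in the images of the ancestors of z (including z).  For the step take B = T_n,
-- A = T_{n+1} and U = T_{n+2}, with L embedded in B and S in A.  In A the first leaf of B has a
-- copy of B as last-born, receiving L, and leaf children l_{P,Q} with c = Q for each principal
-- branch Q of B.  If m is the branch to a vertex a of L, choose Q to be the branch the invariant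
-- gives for a: then c(l_{P,Q}) meets the image of L exactly where c of the child S meets L, so
-- the child S may be sent to l_{P,Q}, and the rest of S into the copy of A that U hangs below it.
-- The branches needed for the invariant are inherited from the copies, except for the root,
-- which uses a second leaf child l_{P,Q'}.
--
-- Everything is computed on addresses (lists of child indices) and transported back to the
-- positions Pos at the end.  Suffix ᵃ: address-level version of the notion in Defs; suffix ᵒ:
-- the same at index j of a list of other children.

module Submission where

open import Data.Empty using (⊥; ⊥-elim)
open import Data.Fin using (Fin; toℕ) renaming (zero to fz; suc to fs)
open import Data.Fin.Properties using (toℕ-injective)
open import Data.List using (List; []; _∷_; [_]; _++_; map; length; lookup)
open import Data.List.Properties using (∷-injectiveˡ; ∷-injectiveʳ; ++-assoc; ++-cancelˡ)
open import Data.List.Relation.Unary.All as All using (All; []; _∷_)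
open import Data.List.Relation.Unary.All.Properties using (++⁺; map⁺)
open import Data.Maybe using (Maybe; just; nothing)
open import Data.Nat using (ℕ; zero; suc; _+_; _≤_; z≤n; s≤s)
open import Data.Nat.Properties using (suc-injective; 0≢1+n; 1+n≢0; +-identityʳ; +-suc; ≤-trans; m≤m+n; m≤n+m; n≤1+n)
open import Data.Product using (Σ; _×_; _,_; proj₁; proj₂)
open import Data.Sum using (_⊎_; inj₁; inj₂)
open import Data.Unit using (⊤; tt)
open import Relation.Binary.PropositionalEquality using (_≡_; refl; sym; trans; cong; cong₂; subst; subst₂)

open import Defs

_⇔_ : Set → Set → Set
A ⇔ B = (A → B) × (B → A)

⇔-trans : ∀ {P Q R : Set} → P ⇔ Q → Q ⇔ R → P ⇔ R
⇔-trans (a , b) (c , d) = (λ p → c (a p)) , (λ r → b (d r))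

nth : {A : Set} → List A → ℕ → Maybe A
nth [] _ = nothing
nth (x ∷ xs) zero = just x
nth (x ∷ xs) (suc j) = nth xs j

_⊑_ : Addr → Addr → Set
[] ⊑ ys = ⊤
(x ∷ xs) ⊑ [] = ⊥
(x ∷ xs) ⊑ (y ∷ ys) = x ≡ y × xs ⊑ ys

Others : Set
Others = List (RT × Maybe Addr)

mutual
  IsVertex : RT → Addr → Set
  IsVertex t [] = ⊤
  IsVertex leaf (_ ∷ _) = ⊥
  IsVertex (node l os) (zero ∷ α) = IsVertex l α
  IsVertex (node l os) (suc j ∷ α) = IsVertexᵒ os j α

  IsVertexᵒ : Others → ℕ → Addr → Set
  IsVertexᵒ [] j α = ⊥
  IsVertexᵒ ((s , m) ∷ os) zero α = IsVertex s α
  IsVertexᵒ (_ ∷ os) (suc j) α = IsVertexᵒ os j α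

mutual
  IsLeaf : RT → Addr → Set
  IsLeaf leaf [] = ⊤
  IsLeaf leaf (_ ∷ _) = ⊥
  IsLeaf (node l os) [] = ⊥
  IsLeaf (node l os) (zero ∷ α) = IsLeaf l α
  IsLeaf (node l os) (suc j ∷ α) = IsLeafᵒ os j α

  IsLeafᵒ : Others → ℕ → Addr → Set
  IsLeafᵒ [] j α = ⊥
  IsLeafᵒ ((s , m) ∷ os) zero α = IsLeaf s α
  IsLeafᵒ (_ ∷ os) (suc j) α = IsLeafᵒ os j α

-- Addresses relative to the parent: the branch labelled a is {0 ∷ γ ∣ γ ⊑ a}.
InLabel : Maybe Addr → Addr → Set
InLabel nothing β = ⊥
InLabel (just a) [] = ⊥
InLabel (just a) (zero ∷ γ) = γ ⊑ a
InLabel (just a) (suc _ ∷ γ) = ⊥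

labelᵒ : Others → ℕ → Maybe Addr
labelᵒ [] j = nothing
labelᵒ ((s , m) ∷ os) zero = m
labelᵒ (_ ∷ os) (suc j) = labelᵒ os j

mutual
  InCᵃ : RT → Addr → Addr → Set
  InCᵃ leaf α β = ⊥
  InCᵃ (node l os) [] β = ⊥
  InCᵃ (node l os) (zero ∷ α) [] = ⊥
  InCᵃ (node l os) (zero ∷ α) (zero ∷ β) = InCᵃ l α β
  InCᵃ (node l os) (zero ∷ α) (suc _ ∷ β) = ⊥
  InCᵃ (node l os) (suc j ∷ []) β = InLabel (labelᵒ os j) β
  InCᵃ (node l os) (suc j ∷ (x ∷ α)) [] = ⊥
  InCᵃ (node l os) (suc j ∷ (x ∷ α)) (zero ∷ β) = ⊥
  InCᵃ (node l os) (suc j ∷ (x ∷ α)) (suc j' ∷ β) = j ≡ j' × InCᵃᵒ os j (x ∷ α) β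

  InCᵃᵒ : Others → ℕ → Addr → Addr → Set
  InCᵃᵒ [] j α β = ⊥
  InCᵃᵒ ((s , m) ∷ os) zero α β = InCᵃ s α β
  InCᵃᵒ (_ ∷ os) (suc j) α β = InCᵃᵒ os j α β

LabOKᵃ : RT → Maybe Addr → Set
LabOKᵃ l nothing = ⊤
LabOKᵃ l (just a) = IsVertex l a

mutual
  WFᵃ : RT → Set
  WFᵃ leaf = ⊤
  WFᵃ (node l os) = WFᵃ l × WFᵃᵒ l os

  WFᵃᵒ : RT → Others → Set
  WFᵃᵒ l [] = ⊤
  WFᵃᵒ l ((s , m) ∷ os) = WFᵃ s × LabOKᵃ l m × WFᵃᵒ l os

IsLBᵃ : Addr → Set
IsLBᵃ [] = ⊥
IsLBᵃ (x ∷ []) = x ≡ 0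
IsLBᵃ (x ∷ y ∷ r) = IsLBᵃ (y ∷ r)

mutual
  posAt : ∀ t α → IsVertex t α → Σ (Pos t) λ p → addr p ≡ α
  posAt t [] v = here , refl
  posAt leaf (_ ∷ _) ()
  posAt (node l os) (zero ∷ α) v with posAt l α v
  ... | p , e = lbP p , cong (0 ∷_) e
  posAt (node l os) (suc j ∷ α) v with posAtᵒ os j α v
  ... | i , ei , p , e = othP i p , cong₂ _∷_ (cong suc ei) e

  posAtᵒ : ∀ os j α → IsVertexᵒ os j α →
           Σ (Fin (length os)) λ i → toℕ i ≡ j × Σ (Pos (proj₁ (lookup os i))) λ p → addr p ≡ α
  posAtᵒ [] j α ()
  posAtᵒ ((s , m) ∷ os) zero α v with posAt s α v
  ... | p , e = fz , refl , p , e
  posAtᵒ (_ ∷ os) (suc j) α v with posAtᵒ os j α v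
  ... | i , ei , p , e = fs i , cong suc ei , p , e

mutual
  addr-IsVertex : ∀ {t} (p : Pos t) → IsVertex t (addr p)
  addr-IsVertex here = tt
  addr-IsVertex (lbP p) = addr-IsVertex p
  addr-IsVertex {node l os} (othP i p) = addr-IsVertexᵒ os i p

  addr-IsVertexᵒ : ∀ os (i : Fin (length os)) (p : Pos (proj₁ (lookup os i))) → IsVertexᵒ os (toℕ i) (addr p)
  addr-IsVertexᵒ (_ ∷ os) fz p = addr-IsVertex p
  addr-IsVertexᵒ (_ ∷ os) (fs i) p = addr-IsVertexᵒ os i p

addr-injective : ∀ {t} (p q : Pos t) → addr p ≡ addr q → p ≡ q
addr-injective here here e = refl
addr-injective here (lbP q) ()
addr-injective here (othP i q) ()
addr-injective (lbP p) here ()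
addr-injective (lbP p) (lbP q) e = cong lbP (addr-injective p q (∷-injectiveʳ e))
addr-injective (lbP p) (othP i q) ()
addr-injective (othP i p) here ()
addr-injective (othP i p) (lbP q) ()
addr-injective (othP i p) (othP i' q) e with toℕ-injective (suc-injective (∷-injectiveˡ e))
... | refl = cong (othP i) (addr-injective p q (∷-injectiveʳ e))

≼⇒⊑ : ∀ {t} {p q : Pos t} → p ≼ q → addr p ⊑ addr q
≼⇒⊑ here≼ = tt
≼⇒⊑ (lb≼ r) = refl , ≼⇒⊑ r
≼⇒⊑ (oth≼ r) = refl , ≼⇒⊑ r

⊑⇒≼ : ∀ {t} (p q : Pos t) → addr p ⊑ addr q → p ≼ q
⊑⇒≼ here q _ = here≼
⊑⇒≼ (lbP p) here ()
⊑⇒≼ (lbP p) (lbP q) (_ , r) = lb≼ (⊑⇒≼ p q r)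
⊑⇒≼ (lbP p) (othP i q) (() , _)
⊑⇒≼ (othP i p) here ()
⊑⇒≼ (othP i p) (lbP q) (() , _)
⊑⇒≼ (othP i p) (othP i' q) (e , r) with toℕ-injective (suc-injective e)
... | refl = oth≼ (⊑⇒≼ p q r)

IsLBᵃ-∷ : ∀ x δ → IsLBᵃ δ → IsLBᵃ (x ∷ δ)
IsLBᵃ-∷ x [] ()
IsLBᵃ-∷ x (y ∷ δ) l = l

IsLB⇒IsLBᵃ : ∀ {t} {p : Pos t} → IsLB p → IsLBᵃ (addr p)
IsLB⇒IsLBᵃ lb-here = refl
IsLB⇒IsLBᵃ {p = lbP p} (lb-lb r) = IsLBᵃ-∷ 0 (addr p) (IsLB⇒IsLBᵃ r)
IsLB⇒IsLBᵃ {p = othP i p} (lb-oth r) = IsLBᵃ-∷ _ (addr p) (IsLB⇒IsLBᵃ r)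

mutual
  IsLBᵃ⇒IsLB : ∀ {t} (p : Pos t) → IsLBᵃ (addr p) → IsLB p
  IsLBᵃ⇒IsLB here ()
  IsLBᵃ⇒IsLB (lbP p) l with IsLBᵃ-tail p 0 l
  ... | inj₁ (_ , refl) = lb-here
  ... | inj₂ r = lb-lb r
  IsLBᵃ⇒IsLB (othP i p) l with IsLBᵃ-tail p _ l
  ... | inj₁ (() , _)
  ... | inj₂ r = lb-oth r

  IsLBᵃ-tail : ∀ {s} (p : Pos s) (x : ℕ) → IsLBᵃ (x ∷ addr p) → (x ≡ 0 × p ≡ here) ⊎ IsLB p
  IsLBᵃ-tail here x l = inj₁ (l , refl)
  IsLBᵃ-tail (lbP p) x l = inj₂ (IsLBᵃ⇒IsLB (lbP p) l)
  IsLBᵃ-tail (othP i p) x l = inj₂ (IsLBᵃ⇒IsLB (othP i p) l)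

labelᵒ-lookup : ∀ (os : Others) (i : Fin (length os)) → labelᵒ os (toℕ i) ≡ proj₂ (lookup os i)
labelᵒ-lookup (_ ∷ os) fz = refl
labelᵒ-lookup (_ ∷ os) (fs i) = labelᵒ-lookup os i

InCᵃᵒ-lookup : ∀ (os : Others) (i : Fin (length os)) α β → InCᵃᵒ os (toℕ i) α β ≡ InCᵃ (proj₁ (lookup os i)) α β
InCᵃᵒ-lookup (_ ∷ os) fz α β = refl
InCᵃᵒ-lookup (_ ∷ os) (fs i) α β = InCᵃᵒ-lookup os i α β

WFᵃᵒ-lookup : ∀ l (os : Others) → WFᵃᵒ l os → (i : Fin (length os)) → WFᵃ (proj₁ (lookup os i))
WFᵃᵒ-lookup l (_ ∷ os) (w , _ , _) fz = w
WFᵃᵒ-lookup l (_ ∷ os) (_ , _ , r) (fs i) = WFᵃᵒ-lookup l os r i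

WFᵃᵒ-label : ∀ l (os : Others) → WFᵃᵒ l os → ∀ j → LabOKᵃ l (labelᵒ os j)
WFᵃᵒ-label l [] _ j = tt
WFᵃᵒ-label l (_ ∷ os) (_ , v , _) zero = v
WFᵃᵒ-label l (_ ∷ os) (_ , _ , r) (suc j) = WFᵃᵒ-label l os r j

here-or-∷ : ∀ {s} (p : Pos s) → (p ≡ here) ⊎ (Σ ℕ λ x → Σ Addr λ α → addr p ≡ x ∷ α)
here-or-∷ here = inj₁ refl
here-or-∷ (lbP p) = inj₂ (_ , _ , refl)
here-or-∷ (othP i p) = inj₂ (_ , _ , refl)

SubC-view : ∀ {s t} (L : Pos t → Set) (emb : Pos s → Pos t) (p : Pos s) w → SubC L emb p w →
            (p ≡ here × L w) ⊎ (Σ (Pos s) λ q → w ≡ emb q × InC p q)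
SubC-view L emb here w r = inj₁ (refl , r)
SubC-view L emb (lbP p) w r = inj₂ r
SubC-view L emb (othP i p) w r = inj₂ r

SubC-intro : ∀ {s t} (L : Pos t → Set) (emb : Pos s → Pos t) (p : Pos s) x α → addr p ≡ x ∷ α →
          ∀ q → InC p q → SubC L emb p (emb q)
SubC-intro L emb here x α () q r
SubC-intro L emb (lbP p) x α e q r = q , refl , r
SubC-intro L emb (othP i p) x α e q r = q , refl , r

LabMem⇒InLabel : ∀ l os m (w : Pos (node l os)) → LabMem l os m w → InLabel m (addr w)
LabMem⇒InLabel l os nothing w ()
LabMem⇒InLabel l os (just a) .(lbP q) (tgt , e , q , refl , r) = subst (addr q ⊑_) e (≼⇒⊑ r)

InLabel⇒LabMem : ∀ l os m → LabOKᵃ l m → (w : Pos (node l os)) → InLabel m (addr w) → LabMem l os m w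
InLabel⇒LabMem l os nothing v w ()
InLabel⇒LabMem l os (just a) v here ()
InLabel⇒LabMem l os (just a) v (othP i q) ()
InLabel⇒LabMem l os (just a) v (lbP q) r with posAt l a v
... | tgt , e = tgt , e , q , refl , ⊑⇒≼ q tgt (subst (addr q ⊑_) (sym e) r)

InCᵃ-othP : ∀ l (os : Others) i (p q : Pos (proj₁ (lookup os i))) x α → addr p ≡ x ∷ α →
        InCᵃ (proj₁ (lookup os i)) (addr p) (addr q) →
        InCᵃ (node l os) (suc (toℕ i) ∷ addr p) (suc (toℕ i) ∷ addr q)
InCᵃ-othP l os i p q x α e c rewrite e = refl , subst (λ X → X) (sym (InCᵃᵒ-lookup os i (x ∷ α) (addr q))) c

InC⇒InCᵃ : ∀ {t} (u w : Pos t) → InC u w → InCᵃ t (addr u) (addr w)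
InC⇒InCᵃ here w ()
InC⇒InCᵃ (lbP p) .(lbP q) (q , refl , r) = InC⇒InCᵃ p q r
InC⇒InCᵃ {node l os} (othP i p) w r with SubC-view (LabMem l os (proj₂ (lookup os i))) (othP i) p w r
... | inj₁ (refl , lm) = subst (λ m → InLabel m (addr w)) (sym (labelᵒ-lookup os i)) (LabMem⇒InLabel l os _ w lm)
... | inj₂ (q , refl , r') with here-or-∷ p
...   | inj₁ refl = ⊥-elim r'
...   | inj₂ (x , α , e) = InCᵃ-othP l os i p q x α e (InC⇒InCᵃ p q r')

root-c-empty : ∀ t β → InCᵃ t [] β → ⊥
root-c-empty leaf β ()
root-c-empty (node l os) β ()

InCᵃ-othP⁻ : ∀ l (os : Others) i (p : Pos (proj₁ (lookup os i))) x α → addr p ≡ x ∷ α → ∀ β →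
         InCᵃ (node l os) (suc (toℕ i) ∷ addr p) (suc (toℕ i) ∷ β) →
         InCᵃ (proj₁ (lookup os i)) (addr p) β
InCᵃ-othP⁻ l os i p x α e β c rewrite e = subst (λ X → X) (InCᵃᵒ-lookup os i (x ∷ α) β) (proj₂ c)

mutual
  InCᵃ⇒InC : ∀ {t} → WFᵃ t → (u w : Pos t) → InCᵃ t (addr u) (addr w) → InC u w
  InCᵃ⇒InC {leaf} wf here w ()
  InCᵃ⇒InC {node l os} wf here w ()
  InCᵃ⇒InC wf (lbP p) here ()
  InCᵃ⇒InC wf (lbP p) (lbP q) c = q , refl , InCᵃ⇒InC (proj₁ wf) p q c
  InCᵃ⇒InC wf (lbP p) (othP i q) ()
  InCᵃ⇒InC {node l os} wf (othP i p) w c with here-or-∷ p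
  ... | inj₁ refl = InLabel⇒LabMem l os (proj₂ (lookup os i))
                      (subst (LabOKᵃ l) (labelᵒ-lookup os i) (WFᵃᵒ-label l os (proj₂ wf) (toℕ i))) w
                      (subst (λ m → InLabel m (addr w)) (labelᵒ-lookup os i) c)
  ... | inj₂ (x , α , e) = InCᵃ⇒InC-othP l os wf i p x α e w c

  InCᵃ⇒InC-othP : ∀ l (os : Others) → WFᵃ (node l os) →
                  ∀ i (p : Pos (proj₁ (lookup os i))) x α → addr p ≡ x ∷ α →
            (w : Pos (node l os)) → InCᵃ (node l os) (suc (toℕ i) ∷ addr p) (addr w) → InC (othP i p) w
  InCᵃ⇒InC-othP l os wf i p x α e here c rewrite e = ⊥-elim c
  InCᵃ⇒InC-othP l os wf i p x α e (lbP q) c rewrite e = ⊥-elim c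
  InCᵃ⇒InC-othP l os wf i p x α e (othP i' q) c
    with toℕ-injective (proj₁ (subst (λ d → InCᵃ (node l os) (suc (toℕ i) ∷ d) (suc (toℕ i') ∷ addr q)) e c))
  ... | refl = SubC-intro (LabMem l os (proj₂ (lookup os i))) (othP i) p x α e q
                 (InCᵃ⇒InC (WFᵃᵒ-lookup l os (proj₂ wf) i) p q (InCᵃ-othP⁻ l os i p x α e (addr q) c))

record AddrEmbedding (T U : RT) : Set where
  field
    f           : Addr → Addr
    f-vertex    : ∀ α → IsVertex T α → IsVertex U (f α)
    f-injective : ∀ α β → IsVertex T α → IsVertex T β → f α ≡ f β → α ≡ β
    f-root      : f [] ≡ []
    f-mono      : ∀ α β → IsVertex T α → IsVertex T β → α ⊑ β → f α ⊑ f β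
    f-lastborn  : ∀ α → IsVertex T α → IsLBᵃ α → IsLBᵃ (f α)
    f-c         : ∀ α β → IsVertex T α → IsVertex T β → InCᵃ T α β ⇔ InCᵃ U (f α) (f β)

AddrEmbedding⇒Extension : ∀ T U → WFᵃ T → WFᵃ U → AddrEmbedding T U → Extension U T
AddrEmbedding⇒Extension T U wT wU embedding = record
  { φ = φ ; inj = inj ; root = addr-injective (φ here) here (trans (φa here) f-root)
  ; anc = anc ; lastb = lastb ; cond-c = cc }
  where
  open AddrEmbedding embedding
  φ : Pos T → Pos U
  φ p = proj₁ (posAt U (f (addr p)) (f-vertex _ (addr-IsVertex p)))
  φa : ∀ p → addr (φ p) ≡ f (addr p)
  φa p = proj₂ (posAt U (f (addr p)) (f-vertex _ (addr-IsVertex p)))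
  inj : ∀ u v → φ u ≡ φ v → u ≡ v
  inj u v e = addr-injective u v (f-injective _ _ (addr-IsVertex u) (addr-IsVertex v)
                 (trans (sym (φa u)) (trans (cong addr e) (φa v))))
  anc : ∀ u v → Anc u v → Anc (φ u) (φ v)
  anc u v (r , ne) = ⊑⇒≼ (φ u) (φ v) (subst₂ _⊑_ (sym (φa u)) (sym (φa v))
                       (f-mono _ _ (addr-IsVertex u) (addr-IsVertex v) (≼⇒⊑ r))) , λ e → ne (inj u v e)
  lastb : ∀ v → IsLB v → IsLB (φ v)
  lastb v l = IsLBᵃ⇒IsLB (φ v) (subst IsLBᵃ (sym (φa v)) (f-lastborn _ (addr-IsVertex v) (IsLB⇒IsLBᵃ l)))
  c⇒ : ∀ v w → InC v w → InC (φ v) (φ w)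
  c⇒ v w c = InCᵃ⇒InC wU (φ v) (φ w) (subst₂ (InCᵃ U) (sym (φa v)) (sym (φa w))
               (proj₁ (f-c _ _ (addr-IsVertex v) (addr-IsVertex w)) (InC⇒InCᵃ v w c)))
  c⇐ : ∀ v w → InC (φ v) (φ w) → InC v w
  c⇐ v w c = InCᵃ⇒InC wT v w (proj₂ (f-c _ _ (addr-IsVertex v) (addr-IsVertex w))
               (subst₂ (InCᵃ U) (φa v) (φa w) (InC⇒InCᵃ (φ v) (φ w) c)))
  cc : ∀ v (w' : Pos U) →
       ((Σ (Pos T) λ w → InC v w × φ w ≡ w') → InC (φ v) w' × Σ (Pos T) λ w → φ w ≡ w')
     × ((InC (φ v) w' × Σ (Pos T) λ w → φ w ≡ w') → Σ (Pos T) λ w → InC v w × φ w ≡ w')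
  cc v w' = (λ { (w , c , refl) → c⇒ v w c , w , refl }) , (λ { (c , w , refl) → w , c⇐ v w c , refl })

++-mono-⊑ : ∀ la {xs ys} → xs ⊑ ys → (la ++ xs) ⊑ (la ++ ys)
++-mono-⊑ [] r = r
++-mono-⊑ (x ∷ la) r = refl , ++-mono-⊑ la r

++-cancel-⊑ : ∀ la {xs ys} → (la ++ xs) ⊑ (la ++ ys) → xs ⊑ ys
++-cancel-⊑ [] r = r
++-cancel-⊑ (x ∷ la) (_ , r) = ++-cancel-⊑ la r

⊑-++ʳ : ∀ (δ la ν : Addr) → δ ⊑ la → δ ⊑ (la ++ ν)
⊑-++ʳ [] la ν r = tt
⊑-++ʳ (x ∷ δ) [] ν ()
⊑-++ʳ (x ∷ δ) (y ∷ la) ν (e , r) = e , ⊑-++ʳ δ la ν r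

[]≢++∷ : ∀ (la : Addr) x ρ → [] ≡ la ++ x ∷ ρ → ⊥
[]≢++∷ [] x ρ ()
[]≢++∷ (_ ∷ _) x ρ ()

IsLBᵃ-++ : ∀ (xs ys : Addr) → IsLBᵃ ys → IsLBᵃ (xs ++ ys)
IsLBᵃ-++ [] ys l = l
IsLBᵃ-++ (x ∷ xs) ys l = IsLBᵃ-∷ x (xs ++ ys) (IsLBᵃ-++ xs ys l)

++∷-nonempty : ∀ (la : Addr) x δ → Σ ℕ λ y → Σ Addr λ ρ → la ++ x ∷ δ ≡ y ∷ ρ
++∷-nonempty [] x δ = x , δ , refl
++∷-nonempty (y ∷ la) x δ = y , la ++ x ∷ δ , refl

root-not-in-c : ∀ t α → InCᵃ t α [] → ⊥
root-not-in-c leaf α ()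
root-not-in-c (node l os) [] ()
root-not-in-c (node l os) (zero ∷ α) ()
root-not-in-c (node l os) (suc j ∷ []) c = lab-nil (labelᵒ os j) c
  where lab-nil : ∀ m → InLabel m [] → ⊥
        lab-nil nothing ()
        lab-nil (just a) ()
root-not-in-c (node l os) (suc j ∷ (x ∷ α)) ()

leafChildren : List Addr → Others
leafChildren xs = map (λ a → (leaf , just a)) xs

nth-++ˡ : ∀ (xs ys : List Addr) j a → nth xs j ≡ just a → nth (xs ++ ys) j ≡ just a
nth-++ˡ [] ys j a ()
nth-++ˡ (x ∷ xs) ys zero a e = e
nth-++ˡ (x ∷ xs) ys (suc j) a e = nth-++ˡ xs ys j a e

nth-++ʳ : ∀ (xs ys : List Addr) k a → nth ys k ≡ just a → nth (xs ++ ys) (length xs + k) ≡ just a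
nth-++ʳ [] ys k a e = e
nth-++ʳ (x ∷ xs) ys k a e = nth-++ʳ xs ys k a e

nth-map : ∀ (g : Addr → Addr) xs j a → nth xs j ≡ just a → nth (map g xs) j ≡ just (g a)
nth-map g [] j a ()
nth-map g (x ∷ xs) zero a refl = refl
nth-map g (x ∷ xs) (suc j) a e = nth-map g xs j a e

mutual
  leaves-IsLeaf : ∀ t → All (IsLeaf t) (leaves t)
  leaves-IsLeaf leaf = tt ∷ []
  leaves-IsLeaf (node l os) =
    ++⁺ (map⁺ (leaves-IsLeaf l)) (All.map (λ { (k , la , refl , lf) → lf }) (leavesO-IsLeaf os 0))

  leavesO-IsLeaf : ∀ os c → All (λ a → Σ ℕ λ k → Σ Addr λ la → a ≡ suc (c + k) ∷ la × IsLeafᵒ os k la)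
                                (leavesO (suc c) os)
  leavesO-IsLeaf [] c = []
  leavesO-IsLeaf ((s , m) ∷ os) c =
    ++⁺ (map⁺ (All.map (λ {a} lf → 0 , a , cong (λ z → suc z ∷ a) (sym (+-identityʳ c)) , lf) (leaves-IsLeaf s)))
        (All.map (λ { (k , la , refl , lf) → suc k , la , cong (λ z → suc z ∷ la) (sym (+-suc c k)) , lf })
                 (leavesO-IsLeaf os (suc c)))

mutual
  IsLeaf⇒nth-leaves : ∀ t la → IsLeaf t la → Σ ℕ λ j → nth (leaves t) j ≡ just la
  IsLeaf⇒nth-leaves leaf [] _ = 0 , refl
  IsLeaf⇒nth-leaves leaf (_ ∷ _) ()
  IsLeaf⇒nth-leaves (node l os) [] ()
  IsLeaf⇒nth-leaves (node l os) (zero ∷ la) lf with IsLeaf⇒nth-leaves l la lf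
  ... | j , e = j , nth-++ˡ (map (0 ∷_) (leaves l)) (leavesO 1 os) j _ (nth-map (0 ∷_) (leaves l) j la e)
  IsLeaf⇒nth-leaves (node l os) (suc k ∷ la) lf with IsLeafᵒ⇒nth-leavesO os k la 1 lf
  ... | i , e = length (map (0 ∷_) (leaves l)) + i , nth-++ʳ (map (0 ∷_) (leaves l)) (leavesO 1 os) i _ e

  IsLeafᵒ⇒nth-leavesO : ∀ os k la c → IsLeafᵒ os k la → Σ ℕ λ i → nth (leavesO c os) i ≡ just ((c + k) ∷ la)
  IsLeafᵒ⇒nth-leavesO [] k la c ()
  IsLeafᵒ⇒nth-leavesO ((s , m) ∷ os) zero la c lf with IsLeaf⇒nth-leaves s la lf
  ... | i , e = i , nth-++ˡ (map (c ∷_) (leaves s)) (leavesO (suc c) os) i _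
                     (subst (λ z → nth (map (c ∷_) (leaves s)) i ≡ just (z ∷ la)) (sym (+-identityʳ c))
                       (nth-map (c ∷_) (leaves s) i la e))
  IsLeafᵒ⇒nth-leavesO ((s , m) ∷ os) (suc k) la c lf with IsLeafᵒ⇒nth-leavesO os k la (suc c) lf
  ... | i , e = length (map (c ∷_) (leaves s)) + i ,
                nth-++ʳ (map (c ∷_) (leaves s)) (leavesO (suc c) os) i _
                  (subst (λ z → nth (leavesO (suc c) os) i ≡ just (z ∷ la)) (sym (+-suc c k)) e)

firstLeaf : RT → Addr
firstLeaf leaf = []
firstLeaf (node l os) = 0 ∷ firstLeaf l

firstLeaf-IsLeaf : ∀ t → IsLeaf t (firstLeaf t)
firstLeaf-IsLeaf leaf = tt
firstLeaf-IsLeaf (node l os) = firstLeaf-IsLeaf l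

leaves-head : ∀ t → Σ (List Addr) λ r → leaves t ≡ firstLeaf t ∷ r
leaves-head leaf = [] , refl
leaves-head (node l os) with leaves l | leaves-head l
... | .(firstLeaf l ∷ r) | r , refl = _ , refl

nth-leaves-0 : ∀ t → nth (leaves t) 0 ≡ just (firstLeaf t)
nth-leaves-0 t with leaves t | leaves-head t
... | .(firstLeaf t ∷ r) | r , refl = refl

graft-second-leaf : ∀ X U → Σ Addr λ b → nth (leaves (graft X U)) 1 ≡ just b
graft-second-leaf X leaf = help (leaves X) (leaves-head X)
  where
  help : ∀ xs → (Σ (List Addr) λ r → xs ≡ firstLeaf X ∷ r) →
         Σ Addr λ b → nth (map (0 ∷_) xs ++ leavesO 1 (leafChildren xs)) 1 ≡ just b
  help .(firstLeaf X ∷ []) ([] , refl) = 1 ∷ [] , refl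
  help .(firstLeaf X ∷ y ∷ r) (y ∷ r , refl) = 0 ∷ y , refl
graft-second-leaf X (node l os) with graft-second-leaf X l
... | b , e = 0 ∷ b , nth-++ˡ (map (0 ∷_) (leaves (graft X l))) (leavesO 1 (graftO X os)) 1 _
                        (nth-map (0 ∷_) (leaves (graft X l)) 1 b e)

leafChildren-nth : ∀ xs j a → nth xs j ≡ just a →
                   IsVertexᵒ (leafChildren xs) j [] × IsLeafᵒ (leafChildren xs) j [] × labelᵒ (leafChildren xs) j ≡ just a
leafChildren-nth [] j a ()
leafChildren-nth (x ∷ xs) zero a refl = tt , tt , refl
leafChildren-nth (x ∷ xs) (suc j) a e = leafChildren-nth xs j a e

mutual
  graft-IsVertex : ∀ X U α → IsVertex U α → IsVertex (graft X U) α
  graft-IsVertex X U [] v = tt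
  graft-IsVertex X leaf (_ ∷ _) ()
  graft-IsVertex X (node l os) (zero ∷ α) v = graft-IsVertex X l α v
  graft-IsVertex X (node l os) (suc j ∷ α) v = graft-IsVertexᵒ X os j α v

  graft-IsVertexᵒ : ∀ X os j α → IsVertexᵒ os j α → IsVertexᵒ (graftO X os) j α
  graft-IsVertexᵒ X [] j α ()
  graft-IsVertexᵒ X ((s , m) ∷ os) zero α v = graft-IsVertex X s α v
  graft-IsVertexᵒ X (_ ∷ os) (suc j) α v = graft-IsVertexᵒ X os j α v

mutual
  graft-IsVertex-below : ∀ X U la δ → IsLeaf U la → IsVertex (graft X leaf) δ → IsVertex (graft X U) (la ++ δ)
  graft-IsVertex-below X leaf [] δ _ v = v
  graft-IsVertex-below X leaf (_ ∷ _) δ () v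
  graft-IsVertex-below X (node l os) [] δ () v
  graft-IsVertex-below X (node l os) (zero ∷ la) δ lf v = graft-IsVertex-below X l la δ lf v
  graft-IsVertex-below X (node l os) (suc j ∷ la) δ lf v = graft-IsVertex-belowᵒ X os j la δ lf v

  graft-IsVertex-belowᵒ : ∀ X os j la δ → IsLeafᵒ os j la → IsVertex (graft X leaf) δ → IsVertexᵒ (graftO X os) j (la ++ δ)
  graft-IsVertex-belowᵒ X [] j la δ () v
  graft-IsVertex-belowᵒ X ((s , m) ∷ os) zero la δ lf v = graft-IsVertex-below X s la δ lf v
  graft-IsVertex-belowᵒ X (_ ∷ os) (suc j) la δ lf v = graft-IsVertex-belowᵒ X os j la δ lf v

mutual
  graft-IsLeaf-below : ∀ X U la δ → IsLeaf U la → IsLeaf (graft X leaf) δ → IsLeaf (graft X U) (la ++ δ)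
  graft-IsLeaf-below X leaf [] δ _ v = v
  graft-IsLeaf-below X leaf (_ ∷ _) δ () v
  graft-IsLeaf-below X (node l os) [] δ () v
  graft-IsLeaf-below X (node l os) (zero ∷ la) δ lf v = graft-IsLeaf-below X l la δ lf v
  graft-IsLeaf-below X (node l os) (suc j ∷ la) δ lf v = graft-IsLeaf-belowᵒ X os j la δ lf v

  graft-IsLeaf-belowᵒ : ∀ X os j la δ → IsLeafᵒ os j la → IsLeaf (graft X leaf) δ → IsLeafᵒ (graftO X os) j (la ++ δ)
  graft-IsLeaf-belowᵒ X [] j la δ () v
  graft-IsLeaf-belowᵒ X ((s , m) ∷ os) zero la δ lf v = graft-IsLeaf-below X s la δ lf v
  graft-IsLeaf-belowᵒ X (_ ∷ os) (suc j) la δ lf v = graft-IsLeaf-belowᵒ X os j la δ lf v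

InCᵃ-lbP : ∀ l os ρ β → InCᵃ (node l os) (zero ∷ ρ) β ⇔ (Σ Addr λ β' → β ≡ zero ∷ β' × InCᵃ l ρ β')
InCᵃ-lbP l os ρ [] = (λ ()) , λ { (_ , () , _) }
InCᵃ-lbP l os ρ (zero ∷ β) = (λ c → β , refl , c) , λ { (_ , refl , c) → c }
InCᵃ-lbP l os ρ (suc k ∷ β) = (λ ()) , λ { (_ , () , _) }

InCᵃ-othP-∷ : ∀ l os j x α β → InCᵃ (node l os) (suc j ∷ (x ∷ α)) β ⇔ (Σ Addr λ β' → β ≡ suc j ∷ β' × InCᵃᵒ os j (x ∷ α) β')
InCᵃ-othP-∷ l os j x α [] = (λ ()) , λ { (_ , () , _) }
InCᵃ-othP-∷ l os j x α (zero ∷ β) = (λ ()) , λ { (_ , () , _) }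
InCᵃ-othP-∷ l os j x α (suc j' ∷ β) = (λ { (refl , c) → β , refl , c }) , λ { (_ , refl , c) → refl , c }

InCᵃ-othP-nonempty : ∀ l os j ρ → (Σ ℕ λ y → Σ Addr λ τ → ρ ≡ y ∷ τ) → ∀ β →
           InCᵃ (node l os) (suc j ∷ ρ) β ⇔ (Σ Addr λ β' → β ≡ suc j ∷ β' × InCᵃᵒ os j ρ β')
InCᵃ-othP-nonempty l os j .(y ∷ τ) (y , τ , refl) β = InCᵃ-othP-∷ l os j y τ β

⇔-∃-compose : ∀ {A : Set} {β : Addr} (k : Addr → Addr) (F G : Addr → Set) (pre : Addr) →
        A ⇔ (Σ Addr λ b1 → β ≡ k b1 × F b1) →
        (∀ b1 → F b1 ⇔ (Σ Addr λ b' → b1 ≡ pre ++ b' × G b')) →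
        A ⇔ (Σ Addr λ b' → β ≡ k (pre ++ b') × G b')
⇔-∃-compose k F G pre (ab , ba) h =
  (λ a → let (b1 , e1 , f1) = ab a ; (b' , e2 , g) = proj₁ (h b1) f1 in b' , trans e1 (cong k e2) , g)
  , λ { (b' , e , g) → ba (pre ++ b' , e , proj₂ (h (pre ++ b')) (b' , refl , g)) }

mutual
  graft-InCᵃ-below : ∀ X U la x δ → IsLeaf U la → ∀ β →
        InCᵃ (graft X U) (la ++ x ∷ δ) β ⇔ (Σ Addr λ β' → β ≡ la ++ β' × InCᵃ (graft X leaf) (x ∷ δ) β')
  graft-InCᵃ-below X leaf [] x δ _ β = (λ c → β , refl , c) , λ { (_ , refl , c) → c }
  graft-InCᵃ-below X leaf (_ ∷ _) x δ () β
  graft-InCᵃ-below X (node l os) [] x δ () β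
  graft-InCᵃ-below X (node l os) (zero ∷ la) x δ lf β =
    ⇔-∃-compose (zero ∷_) (InCᵃ (graft X l) (la ++ x ∷ δ)) (InCᵃ (graft X leaf) (x ∷ δ)) la
      (InCᵃ-lbP (graft X l) (graftO X os) (la ++ x ∷ δ) β) (graft-InCᵃ-below X l la x δ lf)
  graft-InCᵃ-below X (node l os) (suc j ∷ la) x δ lf β =
    ⇔-∃-compose (suc j ∷_) (InCᵃᵒ (graftO X os) j (la ++ x ∷ δ)) (InCᵃ (graft X leaf) (x ∷ δ)) la
      (InCᵃ-othP-nonempty (graft X l) (graftO X os) j (la ++ x ∷ δ) (++∷-nonempty la x δ) β) (graft-InCᵃ-belowᵒ X os j la x δ lf)

  graft-InCᵃ-belowᵒ : ∀ X os j la x δ → IsLeafᵒ os j la → ∀ β →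
         InCᵃᵒ (graftO X os) j (la ++ x ∷ δ) β ⇔ (Σ Addr λ β' → β ≡ la ++ β' × InCᵃ (graft X leaf) (x ∷ δ) β')
  graft-InCᵃ-belowᵒ X [] j la x δ () β
  graft-InCᵃ-belowᵒ X ((s , m) ∷ os) zero la x δ lf β = graft-InCᵃ-below X s la x δ lf β
  graft-InCᵃ-belowᵒ X (_ ∷ os) (suc j) la x δ lf β = graft-InCᵃ-belowᵒ X os j la x δ lf β

labelᵒ-graftO : ∀ X os j → labelᵒ (graftO X os) j ≡ labelᵒ os j
labelᵒ-graftO X [] j = refl
labelᵒ-graftO X ((s , m) ∷ os) zero = refl
labelᵒ-graftO X (_ ∷ os) (suc j) = labelᵒ-graftO X os j

mutual
  graft-InCᵃ-old : ∀ X U α → IsVertex U α → ∀ β → InCᵃ (graft X U) α β ⇔ InCᵃ U α β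
  graft-InCᵃ-old X leaf [] v β = (λ ()) , (λ ())
  graft-InCᵃ-old X leaf (_ ∷ _) () β
  graft-InCᵃ-old X (node l os) [] v β = (λ ()) , (λ ())
  graft-InCᵃ-old X (node l os) (zero ∷ α) v [] = (λ ()) , (λ ())
  graft-InCᵃ-old X (node l os) (zero ∷ α) v (zero ∷ β) = graft-InCᵃ-old X l α v β
  graft-InCᵃ-old X (node l os) (zero ∷ α) v (suc _ ∷ β) = (λ ()) , (λ ())
  graft-InCᵃ-old X (node l os) (suc j ∷ []) v β =
    subst (λ m → InLabel m β) (labelᵒ-graftO X os j) , subst (λ m → InLabel m β) (sym (labelᵒ-graftO X os j))
  graft-InCᵃ-old X (node l os) (suc j ∷ (x ∷ α)) v [] = (λ ()) , (λ ())
  graft-InCᵃ-old X (node l os) (suc j ∷ (x ∷ α)) v (zero ∷ β) = (λ ()) , (λ ())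
  graft-InCᵃ-old X (node l os) (suc j ∷ (x ∷ α)) v (suc j' ∷ β) =
    (λ { (e , c) → e , proj₁ (graft-InCᵃ-oldᵒ X os j (x ∷ α) v β) c }) ,
    (λ { (e , c) → e , proj₂ (graft-InCᵃ-oldᵒ X os j (x ∷ α) v β) c })

  graft-InCᵃ-oldᵒ : ∀ X os j α → IsVertexᵒ os j α → ∀ β → InCᵃᵒ (graftO X os) j α β ⇔ InCᵃᵒ os j α β
  graft-InCᵃ-oldᵒ X [] j α () β
  graft-InCᵃ-oldᵒ X ((s , m) ∷ os) zero α v β = graft-InCᵃ-old X s α v β
  graft-InCᵃ-oldᵒ X (_ ∷ os) (suc j) α v β = graft-InCᵃ-oldᵒ X os j α v β

mutual
  ⊑-leaf-++ : ∀ t (la δ ν : Addr) → IsLeaf t la → IsVertex t δ → δ ⊑ (la ++ ν) → δ ⊑ la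
  ⊑-leaf-++ t la [] ν _ _ _ = tt
  ⊑-leaf-++ leaf [] (_ ∷ _) ν _ () _
  ⊑-leaf-++ leaf (_ ∷ _) _ ν () _ _
  ⊑-leaf-++ (node l os) [] (_ ∷ _) ν () _ _
  ⊑-leaf-++ (node l os) (zero ∷ la) (zero ∷ δ) ν lf v (e , r) = e , ⊑-leaf-++ l la δ ν lf v r
  ⊑-leaf-++ (node l os) (zero ∷ la) (suc _ ∷ δ) ν lf v (() , r)
  ⊑-leaf-++ (node l os) (suc j ∷ la) (zero ∷ δ) ν lf v (() , r)
  ⊑-leaf-++ (node l os) (suc j ∷ la) (suc k ∷ δ) ν lf v (refl , r) = refl , ⊑-leaf-++ᵒ os j la δ ν lf v r

  ⊑-leaf-++ᵒ : ∀ os j (la δ ν : Addr) → IsLeafᵒ os j la → IsVertexᵒ os j δ → δ ⊑ (la ++ ν) → δ ⊑ la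
  ⊑-leaf-++ᵒ [] j la δ ν () v r
  ⊑-leaf-++ᵒ ((s , m) ∷ os) zero la δ ν lf v r = ⊑-leaf-++ s la δ ν lf v r
  ⊑-leaf-++ᵒ (_ ∷ os) (suc j) la δ ν lf v r = ⊑-leaf-++ᵒ os j la δ ν lf v r

leafChildren-WFᵃ : ∀ X {xs} → All (IsVertex X) xs → WFᵃᵒ X (leafChildren xs)
leafChildren-WFᵃ X [] = tt
leafChildren-WFᵃ X (v ∷ vs) = tt , v , leafChildren-WFᵃ X vs

IsLeaf⇒IsVertex : ∀ t la → IsLeaf t la → IsVertex t la
IsLeaf⇒IsVertex leaf [] _ = tt
IsLeaf⇒IsVertex leaf (_ ∷ _) ()
IsLeaf⇒IsVertex (node l os) [] ()
IsLeaf⇒IsVertex (node l os) (zero ∷ la) lf = IsLeaf⇒IsVertex l la lf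
IsLeaf⇒IsVertex (node l os) (suc j ∷ la) lf = go os j lf
  where go : ∀ os j → IsLeafᵒ os j la → IsVertexᵒ os j la
        go [] j ()
        go ((s , m) ∷ os) zero lf = IsLeaf⇒IsVertex s la lf
        go (_ ∷ os) (suc j) lf = go os j lf

LabOKᵃ-graft : ∀ X l m → LabOKᵃ l m → LabOKᵃ (graft X l) m
LabOKᵃ-graft X l nothing v = tt
LabOKᵃ-graft X l (just a) v = graft-IsVertex X l a v

mutual
  graft-WFᵃ : ∀ X U → WFᵃ X → WFᵃ U → WFᵃ (graft X U)
  graft-WFᵃ X leaf wx wu = wx , leafChildren-WFᵃ X (All.map (IsLeaf⇒IsVertex X _) (leaves-IsLeaf X))
  graft-WFᵃ X (node l os) wx (wl , wo) = graft-WFᵃ X l wx wl , graftO-WFᵃ X l os wx wo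

  graftO-WFᵃ : ∀ X l os → WFᵃ X → WFᵃᵒ l os → WFᵃᵒ (graft X l) (graftO X os)
  graftO-WFᵃ X l [] wx _ = tt
  graftO-WFᵃ X l ((s , m) ∷ os) wx (ws , v , wo) = graft-WFᵃ X s wx ws , LabOKᵃ-graft X l m v , graftO-WFᵃ X l os wx wo

Tseq-WFᵃ : ∀ n → WFᵃ (Tseq n)
Tseq-WFᵃ zero = tt
Tseq-WFᵃ (suc zero) = tt
Tseq-WFᵃ (suc (suc k)) = graft-WFᵃ (Tseq (suc k)) (Tseq (suc k)) (Tseq-WFᵃ (suc k)) (Tseq-WFᵃ (suc k))

ExactAt : RT → (Addr → Addr) → Addr → Addr → Set
ExactAt T f la z = ∀ w → IsVertex T w → (f w ⊑ la) ⇔ (w ⊑ z)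

ExactBranch : RT → RT → (Addr → Addr) → Addr → Set
ExactBranch T U f z = Σ Addr λ la → IsLeaf U la × ExactAt T f la z

record Strong (T U : RT) : Set where
  field
    embedding : AddrEmbedding T U
    branch    : ∀ z → IsVertex T z → ExactBranch T U (AddrEmbedding.f embedding) z

ExactLabel : RT → (Addr → Addr) → Addr → Maybe Addr → Set
ExactLabel L f la nothing  = ⊤
ExactLabel L f la (just a) = ExactAt L f la a

InLabel-just : ∀ μ β → InLabel (just μ) β ⇔ (Σ Addr λ γ → β ≡ 0 ∷ γ × γ ⊑ μ)
InLabel-just μ [] = (λ ()) , λ { (_ , () , _) }
InLabel-just μ (zero ∷ γ) = (λ r → γ , refl , r) , λ { (_ , refl , r) → r }
InLabel-just μ (suc _ ∷ γ) = (λ ()) , λ { (_ , () , _) }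

-- With A = next B and U = next A: below the first leaf lB of B, A carries a last-born copy of B
-- ("Lcopy", addresses lB ++ 0 ∷ γ), into which L is embedded, and leaves lB ++ suc j ∷ [] (the
-- l_{P,Q}, "Qleaf") whose c is the j-th principal branch of B, ending at μ.  U hangs a copy of A
-- below such a leaf ("Scopy", addresses lB ++ suc j ∷ 0 ∷ γ), into which S is embedded; the root
-- of S is sent to the leaf itself when its label is a branch, and to the root of the copy (a
-- last-born, with empty c) otherwise.
module NodeStep (L S B : RT) (strongL : Strong L B) (strongS : Strong S (graft B B))
                (j : ℕ) (μ : Addr) (jth-leaf : nth (leaves B) j ≡ just μ)
                (j' : ℕ) (b' : Addr) (j'th-leaf : nth (leaves B) j' ≡ just b') (j'≢j : j' ≡ j → ⊥) where

  A : RT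
  A = graft B B

  U : RT
  U = graft A A

  lB : Addr
  lB = firstLeaf B

  module EL = AddrEmbedding (Strong.embedding strongL)
  module ES = AddrEmbedding (Strong.embedding strongS)

  fL : Addr → Addr
  fL = EL.f

  fS : Addr → Addr
  fS = ES.f

  Node : Maybe Addr → RT
  Node m = node L ((S , m) ∷ [])

  embedS : Maybe Addr → Addr → Addr
  embedS (just a) [] = lB ++ suc j ∷ []
  embedS (just a) (x ∷ α) = lB ++ suc j ∷ 0 ∷ fS (x ∷ α)
  embedS nothing α = lB ++ suc j ∷ 0 ∷ fS α

  embed : Maybe Addr → Addr → Addr
  embed m [] = []
  embed m (zero ∷ α) = lB ++ 0 ∷ fL α
  embed m (suc zero ∷ α) = embedS m α
  embed m (suc (suc k) ∷ α) = []

  firstLeaf-B : IsLeaf B lB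
  firstLeaf-B = firstLeaf-IsLeaf B

  jth-leafChild : IsVertexᵒ (leafChildren (leaves B)) j [] × IsLeafᵒ (leafChildren (leaves B)) j []
                × labelᵒ (leafChildren (leaves B)) j ≡ just μ
  jth-leafChild = leafChildren-nth (leaves B) j μ jth-leaf

  Qleaf-IsLeaf : IsLeaf A (lB ++ suc j ∷ [])
  Qleaf-IsLeaf = graft-IsLeaf-below B B lB (suc j ∷ []) firstLeaf-B (proj₁ (proj₂ jth-leafChild))

  Qleaf-IsVertex : IsVertex A (lB ++ suc j ∷ [])
  Qleaf-IsVertex = graft-IsVertex-below B B lB (suc j ∷ []) firstLeaf-B (proj₁ jth-leafChild)

  Lcopy-IsVertex : ∀ γ → IsVertex B γ → IsVertex A (lB ++ 0 ∷ γ)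
  Lcopy-IsVertex γ v = graft-IsVertex-below B B lB (0 ∷ γ) firstLeaf-B v

  lb≢other : ∀ x ρ → lB ++ 0 ∷ x ≡ lB ++ suc j ∷ ρ → ⊥
  lb≢other x ρ e with ∷-injectiveˡ (++-cancelˡ lB _ _ e)
  ... | ()

  embedS-form : ∀ m α → Σ Addr λ ρ → embedS m α ≡ lB ++ suc j ∷ ρ
  embedS-form (just a) [] = [] , refl
  embedS-form (just a) (x ∷ α) = _ , refl
  embedS-form nothing α = _ , refl

  InCᵃ-Lcopy : ∀ γ → IsVertex B γ → ∀ δ →
               InCᵃ U (lB ++ 0 ∷ γ) δ ⇔ (Σ Addr λ γ' → δ ≡ lB ++ 0 ∷ γ' × InCᵃ B γ γ')
  InCᵃ-Lcopy γ v δ = ⇔-trans (graft-InCᵃ-old A A (lB ++ 0 ∷ γ) (Lcopy-IsVertex γ v) δ)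
                 (⇔-∃-compose (lB ++_) (InCᵃ (graft B leaf) (0 ∷ γ)) (InCᵃ B γ) (0 ∷ [])
                    (graft-InCᵃ-below B B lB 0 γ firstLeaf-B δ) (λ b1 → InCᵃ-lbP B (leafChildren (leaves B)) γ b1))

  InCᵃ-Scopy : ∀ γ δ → InCᵃ U (lB ++ suc j ∷ 0 ∷ γ) δ ⇔ (Σ Addr λ γ' → δ ≡ lB ++ suc j ∷ 0 ∷ γ' × InCᵃ A γ γ')
  InCᵃ-Scopy γ δ with ⇔-∃-compose ((lB ++ suc j ∷ []) ++_) (InCᵃ (graft A leaf) (0 ∷ γ)) (InCᵃ A γ) (0 ∷ [])
                  (graft-InCᵃ-below A A (lB ++ suc j ∷ []) 0 γ Qleaf-IsLeaf δ) (λ b1 → InCᵃ-lbP A (leafChildren (leaves A)) γ b1)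
  ... | (a , b) =
    (λ c → let (γ' , e , c') = a (subst (λ z → InCᵃ U z δ) (sym (++-assoc lB [ suc j ] (0 ∷ γ))) c)
           in γ' , trans e (++-assoc lB [ suc j ] (0 ∷ γ')) , c') ,
    (λ { (γ' , e , c') → subst (λ z → InCᵃ U z δ) (++-assoc lB [ suc j ] (0 ∷ γ))
                           (b (γ' , trans e (sym (++-assoc lB [ suc j ] (0 ∷ γ'))) , c')) })

  InCᵃ-Qleaf : ∀ δ → InCᵃ U (lB ++ suc j ∷ []) δ ⇔ (Σ Addr λ γ → δ ≡ lB ++ 0 ∷ γ × γ ⊑ μ)
  InCᵃ-Qleaf δ = ⇔-trans (graft-InCᵃ-old A A (lB ++ suc j ∷ []) Qleaf-IsVertex δ)
             (⇔-∃-compose (lB ++_) (InCᵃ (graft B leaf) (suc j ∷ [])) (_⊑ μ) (0 ∷ [])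
               (graft-InCᵃ-below B B lB (suc j) [] firstLeaf-B δ)
               (λ b1 → ⇔-trans (subst (λ m → InLabel m b1) (proj₂ (proj₂ jth-leafChild)) ,
                               subst (λ m → InLabel m b1) (sym (proj₂ (proj₂ jth-leafChild))))
                              (InLabel-just μ b1)))

  embed-vertex : ∀ m α → IsVertex (Node m) α → IsVertex U (embed m α)
  embed-vertex m [] v = tt
  embed-vertex m (zero ∷ α) v = graft-IsVertex A A (lB ++ 0 ∷ fL α) (Lcopy-IsVertex (fL α) (EL.f-vertex α v))
  embed-vertex (just a) (suc zero ∷ []) v = graft-IsVertex A A (lB ++ suc j ∷ []) Qleaf-IsVertex
  embed-vertex (just a) (suc zero ∷ (x ∷ α)) v =
    subst (IsVertex U) (++-assoc lB [ suc j ] (0 ∷ fS (x ∷ α)))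
      (graft-IsVertex-below A A _ (0 ∷ fS (x ∷ α)) Qleaf-IsLeaf (ES.f-vertex (x ∷ α) v))
  embed-vertex nothing (suc zero ∷ α) v =
    subst (IsVertex U) (++-assoc lB [ suc j ] (0 ∷ fS α)) (graft-IsVertex-below A A _ (0 ∷ fS α) Qleaf-IsLeaf (ES.f-vertex α v))
  embed-vertex m (suc (suc k) ∷ α) ()

  embedS-injective : ∀ m α β → IsVertex S α → IsVertex S β → embedS m α ≡ embedS m β → α ≡ β
  embedS-injective (just a) [] [] va vb e = refl
  embedS-injective (just a) [] (y ∷ β) va vb e with ∷-injectiveʳ (++-cancelˡ lB _ _ e)
  ... | ()
  embedS-injective (just a) (x ∷ α) [] va vb e with ∷-injectiveʳ (++-cancelˡ lB _ _ e)
  ... | ()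
  embedS-injective (just a) (x ∷ α) (y ∷ β) va vb e = ES.f-injective _ _ va vb (∷-injectiveʳ (∷-injectiveʳ (++-cancelˡ lB _ _ e)))
  embedS-injective nothing α β va vb e = ES.f-injective _ _ va vb (∷-injectiveʳ (∷-injectiveʳ (++-cancelˡ lB _ _ e)))

  embed-injective : ∀ m α β → IsVertex (Node m) α → IsVertex (Node m) β → embed m α ≡ embed m β → α ≡ β
  embed-injective m [] [] va vb e = refl
  embed-injective m [] (zero ∷ β) va vb e = ⊥-elim ([]≢++∷ lB 0 _ e)
  embed-injective m [] (suc zero ∷ β) va vb e = ⊥-elim ([]≢++∷ lB (suc j) _ (trans e (proj₂ (embedS-form m β))))
  embed-injective m (zero ∷ α) [] va vb e = ⊥-elim ([]≢++∷ lB 0 _ (sym e))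
  embed-injective m (zero ∷ α) (zero ∷ β) va vb e = cong (0 ∷_) (EL.f-injective α β va vb (∷-injectiveʳ (++-cancelˡ lB _ _ e)))
  embed-injective m (zero ∷ α) (suc zero ∷ β) va vb e = ⊥-elim (lb≢other _ _ (trans e (proj₂ (embedS-form m β))))
  embed-injective m (suc zero ∷ α) [] va vb e = ⊥-elim ([]≢++∷ lB (suc j) _ (trans (sym e) (proj₂ (embedS-form m α))))
  embed-injective m (suc zero ∷ α) (zero ∷ β) va vb e = ⊥-elim (lb≢other _ _ (trans (sym e) (proj₂ (embedS-form m α))))
  embed-injective m (suc zero ∷ α) (suc zero ∷ β) va vb e = cong (1 ∷_) (embedS-injective m α β va vb e)
  embed-injective m (suc (suc k) ∷ α) β () vb e
  embed-injective m α (suc (suc k) ∷ β) va () e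

  embedS-mono : ∀ m α β → IsVertex S α → IsVertex S β → α ⊑ β → embedS m α ⊑ embedS m β
  embedS-mono (just a) [] [] va vb r = ++-mono-⊑ lB (refl , tt)
  embedS-mono (just a) [] (y ∷ β) va vb r = ++-mono-⊑ lB (refl , tt)
  embedS-mono (just a) (x ∷ α) [] va vb ()
  embedS-mono (just a) (x ∷ α) (y ∷ β) va vb r = ++-mono-⊑ lB (refl , refl , ES.f-mono _ _ va vb r)
  embedS-mono nothing α β va vb r = ++-mono-⊑ lB (refl , refl , ES.f-mono _ _ va vb r)

  embed-mono : ∀ m α β → IsVertex (Node m) α → IsVertex (Node m) β → α ⊑ β → embed m α ⊑ embed m β
  embed-mono m [] β va vb r = tt
  embed-mono m (zero ∷ α) [] va vb ()
  embed-mono m (zero ∷ α) (zero ∷ β) va vb (_ , r) = ++-mono-⊑ lB (refl , EL.f-mono α β va vb r)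
  embed-mono m (zero ∷ α) (suc _ ∷ β) va vb (() , r)
  embed-mono m (suc zero ∷ α) [] va vb ()
  embed-mono m (suc zero ∷ α) (zero ∷ β) va vb (() , r)
  embed-mono m (suc zero ∷ α) (suc zero ∷ β) va vb (_ , r) = embedS-mono m α β va vb r
  embed-mono m (suc zero ∷ α) (suc (suc k) ∷ β) va () r
  embed-mono m (suc (suc k) ∷ α) β () vb r

  embedS-∷ : ∀ m y β → embedS m (y ∷ β) ≡ lB ++ suc j ∷ 0 ∷ fS (y ∷ β)
  embedS-∷ (just a) y β = refl
  embedS-∷ nothing y β = refl

  embed-lastborn : ∀ m α → IsVertex (Node m) α → IsLBᵃ α → IsLBᵃ (embed m α)
  embed-lastborn m [] v ()
  embed-lastborn m (zero ∷ []) v l = IsLBᵃ-++ lB (0 ∷ fL []) (subst (λ z → IsLBᵃ (0 ∷ z)) (sym EL.f-root) refl)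
  embed-lastborn m (zero ∷ (x ∷ α)) v l =
    IsLBᵃ-++ lB (0 ∷ fL (x ∷ α)) (IsLBᵃ-∷ 0 (fL (x ∷ α)) (EL.f-lastborn (x ∷ α) v l))
  embed-lastborn m (suc zero ∷ []) v ()
  embed-lastborn m (suc zero ∷ (x ∷ α)) v l =
    subst IsLBᵃ (sym (embedS-∷ m x α))
      (IsLBᵃ-++ lB (suc j ∷ 0 ∷ fS (x ∷ α)) (IsLBᵃ-++ (suc j ∷ 0 ∷ []) (fS (x ∷ α)) (ES.f-lastborn (x ∷ α) v l)))
  embed-lastborn m (suc (suc k) ∷ α) () l

  embedS-inverse : ∀ m β γ → embedS m β ≡ lB ++ suc j ∷ 0 ∷ γ → γ ≡ fS β
  embedS-inverse (just a) [] γ e with ∷-injectiveʳ (++-cancelˡ lB _ _ e)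
  ... | ()
  embedS-inverse (just a) (y ∷ β) γ e = sym (∷-injectiveʳ (∷-injectiveʳ (++-cancelˡ lB _ _ e)))
  embedS-inverse nothing β γ e = sym (∷-injectiveʳ (∷-injectiveʳ (++-cancelˡ lB _ _ e)))

  embed-c-lb : ∀ m α β → IsVertex L α → IsVertex (Node m) β →
               InCᵃ (Node m) (zero ∷ α) β ⇔ InCᵃ U (lB ++ 0 ∷ fL α) (embed m β)
  embed-c-lb m α [] va vb = (λ ()) , (λ c → let (γ' , e , _) = proj₁ (InCᵃ-Lcopy (fL α) (EL.f-vertex α va) []) c in []≢++∷ lB 0 γ' e)
  embed-c-lb m α (zero ∷ β) va vb =
    (λ c → proj₂ (InCᵃ-Lcopy (fL α) (EL.f-vertex α va) _) (fL β , refl , proj₁ (EL.f-c α β va vb) c)) ,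
    (λ c → let (γ' , e , c') = proj₁ (InCᵃ-Lcopy (fL α) (EL.f-vertex α va) _) c
           in proj₂ (EL.f-c α β va vb) (subst (InCᵃ B (fL α)) (sym (∷-injectiveʳ (++-cancelˡ lB _ _ e))) c'))
  embed-c-lb m α (suc zero ∷ β) va vb =
    (λ ()) , (λ c → let (γ' , e , _) = proj₁ (InCᵃ-Lcopy (fL α) (EL.f-vertex α va) _) c
                    in ⊥-elim (lb≢other γ' _ (trans (sym e) (proj₂ (embedS-form m β)))))
  embed-c-lb m α (suc (suc k) ∷ β) va ()

  embed-c-otherRoot : ∀ a → ExactLabel L fL μ (just a) → ∀ β → IsVertex (Node (just a)) β →
        InCᵃ (Node (just a)) (suc zero ∷ []) β ⇔ InCᵃ U (lB ++ suc j ∷ []) (embed (just a) β)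
  embed-c-otherRoot a lp [] vb = (λ ()) , (λ c → let (γ , e , _) = proj₁ (InCᵃ-Qleaf []) c in []≢++∷ lB 0 γ e)
  embed-c-otherRoot a lp (zero ∷ β) vb =
    (λ r → proj₂ (InCᵃ-Qleaf _) (fL β , refl , proj₂ (lp β vb) r)) ,
    (λ c → let (γ , e , r) = proj₁ (InCᵃ-Qleaf _) c
           in proj₁ (lp β vb) (subst (_⊑ μ) (sym (∷-injectiveʳ (++-cancelˡ lB _ _ e))) r))
  embed-c-otherRoot a lp (suc zero ∷ β) vb =
    (λ ()) , (λ c → let (γ , e , _) = proj₁ (InCᵃ-Qleaf _) c
                    in ⊥-elim (lb≢other γ _ (trans (sym e) (proj₂ (embedS-form (just a) β)))))
  embed-c-otherRoot a lp (suc (suc k) ∷ β) ()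

  embed-c-otherBelow : ∀ m x α β → IsVertex S (x ∷ α) → IsVertex (Node m) β →
        InCᵃ (Node m) (suc zero ∷ (x ∷ α)) β ⇔ InCᵃ U (lB ++ suc j ∷ 0 ∷ fS (x ∷ α)) (embed m β)
  embed-c-otherBelow m x α [] va vb = (λ ()) , (λ c → let (γ , e , _) = proj₁ (InCᵃ-Scopy _ []) c in []≢++∷ lB (suc j) _ e)
  embed-c-otherBelow m x α (zero ∷ β) va vb = (λ ()) , (λ c → let (γ , e , _) = proj₁ (InCᵃ-Scopy _ _) c in lb≢other _ _ e)
  embed-c-otherBelow m x α (suc zero ∷ []) va vb =
    (λ { (_ , c) → ⊥-elim (root-not-in-c S (x ∷ α) c) }) ,
    (λ c → let (γ , e , c') = proj₁ (InCᵃ-Scopy _ _) c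
           in ⊥-elim (root-not-in-c A (fS (x ∷ α)) (subst (InCᵃ A (fS (x ∷ α))) (trans (embedS-inverse m [] γ e) ES.f-root) c')))
  embed-c-otherBelow m x α (suc zero ∷ (y ∷ β)) va vb =
    (λ { (_ , c) → proj₂ (InCᵃ-Scopy _ _) (fS (y ∷ β) , embedS-∷ m y β , proj₁ (ES.f-c (x ∷ α) (y ∷ β) va vb) c) }) ,
    (λ c → let (γ , e , c') = proj₁ (InCᵃ-Scopy _ _) c
           in refl , proj₂ (ES.f-c _ _ va vb) (subst (InCᵃ A (fS (x ∷ α))) (embedS-inverse m (y ∷ β) γ e) c'))
  embed-c-otherBelow m x α (suc (suc k) ∷ β) va ()

  embed-c-other : ∀ m → ExactLabel L fL μ m → ∀ α β → IsVertex S α → IsVertex (Node m) β →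
        InCᵃ (Node m) (suc zero ∷ α) β ⇔ InCᵃ U (embedS m α) (embed m β)
  embed-c-other (just a) lp [] β va vb = embed-c-otherRoot a lp β vb
  embed-c-other (just a) lp (x ∷ α) β va vb = embed-c-otherBelow (just a) x α β va vb
  embed-c-other nothing lp [] β va vb =
    (λ ()) , (λ c → let (γ' , e , c') = proj₁ (InCᵃ-Scopy (fS []) (embed nothing β)) c
                    in root-c-empty A γ' (subst (λ z → InCᵃ A z γ') ES.f-root c'))
  embed-c-other nothing lp (x ∷ α) β va vb = embed-c-otherBelow nothing x α β va vb

  embed-c : ∀ m → ExactLabel L fL μ m → ∀ α β → IsVertex (Node m) α → IsVertex (Node m) β →
            InCᵃ (Node m) α β ⇔ InCᵃ U (embed m α) (embed m β)
  embed-c m lp [] β va vb = (λ ()) , (λ c → ⊥-elim (root-c-empty U (embed m β) c))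
  embed-c m lp (zero ∷ α) β va vb = embed-c-lb m α β va vb
  embed-c m lp (suc zero ∷ α) β va vb = embed-c-other m lp α β va vb
  embed-c m lp (suc (suc k) ∷ α) β () vb

  -- This branch passes through the leaf child j' ≠ j of lB, so it leaves the image right after the root.
  rootBranchLeaf : Addr
  rootBranchLeaf = lB ++ suc j' ∷ suc 0 ∷ []

  rootBranchLeaf-IsLeaf : IsLeaf U rootBranchLeaf
  rootBranchLeaf-IsLeaf = subst (IsLeaf U) (++-assoc lB [ suc j' ] (suc 0 ∷ []))
           (graft-IsLeaf-below A A (lB ++ suc j' ∷ []) (suc 0 ∷ [])
             (graft-IsLeaf-below B B lB (suc j' ∷ []) firstLeaf-B (proj₁ (proj₂ (leafChildren-nth (leaves B) j' b' j'th-leaf))))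
             (proj₁ (proj₂ (leafChildren-nth (leaves A) 0 (firstLeaf A) (nth-leaves-0 A)))))

  branch-root : ∀ m → ExactBranch (Node m) U (embed m) []
  branch-root m = rootBranchLeaf , rootBranchLeaf-IsLeaf , exact
    where
    exact : ExactAt (Node m) (embed m) rootBranchLeaf []
    exact [] vw = (λ _ → tt) , (λ _ → tt)
    exact (zero ∷ w) vw = (λ r → ⊥-elim (0≢1+n (proj₁ (++-cancel-⊑ lB r)))) , (λ ())
    exact (suc zero ∷ w) vw =
      (λ r → ⊥-elim (j'≢j (sym (suc-injective
               (proj₁ (++-cancel-⊑ lB (subst (_⊑ rootBranchLeaf) (proj₂ (embedS-form m w)) r))))))) ,
      (λ ())
    exact (suc (suc k) ∷ w) ()

  branch-lb : ∀ m z → IsVertex L z → ExactBranch (Node m) U (embed m) (zero ∷ z)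
  branch-lb m z vz with Strong.branch strongL z vz
  ... | βz , lfz , ivz = lB ++ 0 ∷ (βz ++ 0 ∷ firstLeaf A) , isLeaf , exact
    where
    isLeaf : IsLeaf U (lB ++ 0 ∷ (βz ++ 0 ∷ firstLeaf A))
    isLeaf = subst (IsLeaf U) (++-assoc lB (0 ∷ βz) (0 ∷ firstLeaf A))
               (graft-IsLeaf-below A A (lB ++ 0 ∷ βz) (0 ∷ firstLeaf A)
                 (graft-IsLeaf-below B B lB (0 ∷ βz) firstLeaf-B lfz) (firstLeaf-IsLeaf A))
    exact : ExactAt (Node m) (embed m) (lB ++ 0 ∷ (βz ++ 0 ∷ firstLeaf A)) (zero ∷ z)
    exact [] vw = (λ _ → tt) , (λ _ → tt)
    exact (zero ∷ w) vw =
      (λ r → refl , proj₁ (ivz w vw) (⊑-leaf-++ B βz (fL w) (0 ∷ firstLeaf A) lfz (EL.f-vertex w vw) (proj₂ (++-cancel-⊑ lB r)))) ,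
      (λ { (_ , r) → ++-mono-⊑ lB (refl , ⊑-++ʳ (fL w) βz (0 ∷ firstLeaf A) (proj₂ (ivz w vw) r)) })
    exact (suc zero ∷ w) vw =
      (λ r → ⊥-elim (1+n≢0
               (proj₁ (++-cancel-⊑ lB (subst (_⊑ (lB ++ 0 ∷ (βz ++ 0 ∷ firstLeaf A))) (proj₂ (embedS-form m w)) r))))) ,
      (λ { (() , _) })
    exact (suc (suc k) ∷ w) ()

  branch-other : ∀ m z → IsVertex S z → ExactBranch (Node m) U (embed m) (suc zero ∷ z)
  branch-other m z vz with Strong.branch strongS z vz
  ... | βz , lfz , ivz = lB ++ suc j ∷ 0 ∷ βz , isLeaf , exact
    where
    isLeaf : IsLeaf U (lB ++ suc j ∷ 0 ∷ βz)
    isLeaf = subst (IsLeaf U) (++-assoc lB [ suc j ] (0 ∷ βz))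
               (graft-IsLeaf-below A A (lB ++ suc j ∷ []) (0 ∷ βz) Qleaf-IsLeaf lfz)
    exact-copy : ∀ w → IsVertex S w → ((lB ++ suc j ∷ 0 ∷ fS w) ⊑ (lB ++ suc j ∷ 0 ∷ βz)) ⇔ (1 ≡ 1 × w ⊑ z)
    exact-copy w vw = (λ r → refl , proj₁ (ivz w vw) (proj₂ (proj₂ (++-cancel-⊑ lB r)))) ,
                      (λ { (_ , r) → ++-mono-⊑ lB (refl , refl , proj₂ (ivz w vw) r) })
    exact-S : ∀ m' w → IsVertex S w → (embedS m' w ⊑ (lB ++ suc j ∷ 0 ∷ βz)) ⇔ (1 ≡ 1 × w ⊑ z)
    exact-S (just a) [] vw = (λ _ → refl , tt) , (λ _ → ++-mono-⊑ lB (refl , tt))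
    exact-S (just a) (x ∷ w) vw = exact-copy (x ∷ w) vw
    exact-S nothing w vw = exact-copy w vw
    exact : ExactAt (Node m) (embed m) (lB ++ suc j ∷ 0 ∷ βz) (suc zero ∷ z)
    exact [] vw = (λ _ → tt) , (λ _ → tt)
    exact (zero ∷ w) vw = (λ r → ⊥-elim (0≢1+n (proj₁ (++-cancel-⊑ lB r)))) , (λ { (() , _) })
    exact (suc zero ∷ w) vw = exact-S m w vw
    exact (suc (suc k) ∷ w) ()

  embed-branch : ∀ m z → IsVertex (Node m) z → ExactBranch (Node m) U (embed m) z
  embed-branch m [] _ = branch-root m
  embed-branch m (zero ∷ z) vz = branch-lb m z vz
  embed-branch m (suc zero ∷ z) vz = branch-other m z vz
  embed-branch m (suc (suc k) ∷ z) ()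

  strong : ∀ m → ExactLabel L fL μ m → Strong (Node m) U
  strong m lp = record
    { embedding = record { f = embed m ; f-vertex = embed-vertex m ; f-injective = embed-injective m ; f-root = refl
                  ; f-mono = embed-mono m ; f-lastborn = embed-lastborn m ; f-c = embed-c m lp }
    ; branch = embed-branch m }

LabOK⇒LabOKᵃ : ∀ {l m} → LabOK l m → LabOKᵃ l m
LabOK⇒LabOKᵃ noLab = tt
LabOK⇒LabOKᵃ (someLab p) = addr-IsVertex p

mutual
  WF⇒WFᵃ : ∀ {t} → WF t → WFᵃ t
  WF⇒WFᵃ leafW = tt
  WF⇒WFᵃ (nodeW wl ws) = WF⇒WFᵃ wl , WF⇒WFᵃᵒ ws

  WF⇒WFᵃᵒ : ∀ {l os} → All (λ sm → WF (proj₁ sm) × LabOK l (proj₂ sm)) os → WFᵃᵒ l os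
  WF⇒WFᵃᵒ [] = tt
  WF⇒WFᵃᵒ ((w , lo) ∷ ws) = WF⇒WFᵃ w , LabOK⇒LabOKᵃ lo , WF⇒WFᵃᵒ ws

leaf-strong : ∀ U → Strong leaf U
leaf-strong U = record
  { embedding = record { f = λ α → α ; f-vertex = vertex ; f-injective = λ _ _ _ _ e → e ; f-root = refl
                       ; f-mono = λ _ _ _ _ r → r ; f-lastborn = λ _ _ l → l ; f-c = c }
  ; branch = branch }
  where
  vertex : ∀ α → IsVertex leaf α → IsVertex U α
  vertex [] v = tt
  vertex (_ ∷ _) ()
  c : ∀ α β → IsVertex leaf α → IsVertex leaf β → InCᵃ leaf α β ⇔ InCᵃ U α β
  c [] β _ _ = (λ ()) , (λ c → ⊥-elim (root-c-empty U β c))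
  c (_ ∷ _) β () _
  branch : ∀ z → IsVertex leaf z → ExactBranch leaf U (λ α → α) z
  branch [] _ = firstLeaf U , firstLeaf-IsLeaf U , λ { [] _ → (λ _ → tt) , (λ _ → tt) ; (_ ∷ _) () }
  branch (_ ∷ _) ()

EventuallyStrong : RT → Set
EventuallyStrong T = Σ ℕ λ k → ∀ n → k ≤ n → Strong T (Tseq n)

other-leaf : ∀ B → (Σ Addr λ b → nth (leaves B) 1 ≡ just b) → ∀ j →
             Σ ℕ λ j' → Σ Addr λ b' → nth (leaves B) j' ≡ just b' × (j' ≡ j → ⊥)
other-leaf B (b , e) zero = 1 , b , e , λ ()
other-leaf B _ (suc j) = 0 , firstLeaf B , nth-leaves-0 B , λ ()

eventuallyStrong-node : ∀ l s m → LabOKᵃ l m → EventuallyStrong l → EventuallyStrong s →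
                        EventuallyStrong (node l ((s , m) ∷ []))
eventuallyStrong-node l s m lm (kL , eventuallyL) (kS , eventuallyS) = 4 + (kL + kS) , strong
  where
  strong : ∀ n → 4 + (kL + kS) ≤ n → Strong (node l ((s , m) ∷ [])) (Tseq n)
  strong (suc (suc (suc (suc n)))) (s≤s (s≤s (s≤s (s≤s k≤n)))) = withLabel m lm
    where
    C : RT
    C = Tseq (1 + n)
    B : RT
    B = Tseq (2 + n)
    strongL : Strong l B
    strongL = eventuallyL (2 + n) (≤-trans (m≤m+n kL kS) (≤-trans k≤n (m≤n+m n 2)))
    strongS : Strong s (graft B B)
    strongS = eventuallyS (3 + n) (≤-trans (m≤n+m kS kL) (≤-trans k≤n (m≤n+m n 3)))
    atLeaf : ∀ j μ → nth (leaves B) j ≡ just μ → ∀ m' → ExactLabel l (AddrEmbedding.f (Strong.embedding strongL)) μ m' →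
             Strong (node l ((s , m') ∷ [])) (Tseq (4 + n))
    atLeaf j μ e m' exact with other-leaf B (graft-second-leaf C C) j
    ... | j' , b' , e' , j'≢j = NodeStep.strong l s B strongL strongS j μ e j' b' e' j'≢j m' exact
    withLabel : ∀ m' → LabOKᵃ l m' → Strong (node l ((s , m') ∷ [])) (Tseq (4 + n))
    withLabel nothing _ = atLeaf 0 (firstLeaf B) (nth-leaves-0 B) nothing tt
    withLabel (just a) va with Strong.branch strongL a va
    ... | μ , lfμ , exact with IsLeaf⇒nth-leaves B μ lfμ
    ... | j , e = atLeaf j μ e (just a) exact

eventuallyStrong : ∀ T → WF T → Binary T → EventuallyStrong T
eventuallyStrong leaf _ _ = 1 , λ n _ → leaf-strong (Tseq n)
eventuallyStrong (node l ((s , m) ∷ [])) (nodeW wl ((ws , lo) ∷ [])) (nodeB bl bs) =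
  eventuallyStrong-node l s m (LabOK⇒LabOKᵃ lo) (eventuallyStrong l wl bl) (eventuallyStrong s ws bs)

lemma4p8 : (T : RT) → WF T → Binary T → Σ ℕ λ i → 1 ≤ i × Extension (Tseq i) T
lemma4p8 T wf bin with eventuallyStrong T wf bin
... | k , strong =
  suc k , s≤s z≤n ,
  AddrEmbedding⇒Extension T (Tseq (suc k)) (WF⇒WFᵃ wf) (Tseq-WFᵃ (suc k)) (Strong.embedding (strong (suc k) (n≤1+n k)))
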